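{- $\displaystyle\sum_{n\ge0}|\mathrm{VHC}(\operatorname{Av}_n(132,321))|x^n=\frac{1-3x+3x^2}{(1-x)^4}.$
   Context: $S_n$ is the set of permutations of $[n]$ ($S_0$ contains only the empty permutation); $\operatorname{Av}_n(132,321)$ is the set of $\pi\in S_n$ having no subsequence in the same relative order as $132$ or as $321$. Valid hook configurations. For $\pi=\pi_1\cdots\pi_n$, a descent is $i\in[n-1]$ with $\pi_i>\pi_{i+1}$, and $(i,\pi_i)$ is a descent top of the plot $\{(i,\pi_i)\}$. A hook is determined by $i<j$ with $\pi_i<\pi_j$: vertical segment from $(i,\pi_i)$ up to $(i,\pi_j)$, then horizontal segment to $(j,\pi_j)$; southwest endpoint $(i,\pi_i)$, northeast endpoint $(j,\pi_j)$. If $\pi$ has descents $d_1<\cdots<d_k$, a valid hook configuration is a tuple $(H_1,\dots,H_k)$ of hooks such that (1) $H_i$ has southwest endpoint $(d_i,\pi_{d_i})$; (2) no point of the plot lies directly above a hook; (3) hooks do not intersect or overlap except that the northeast endpoint of one may be the southwest endpoint of another. $\mathrm{VHC}(\pi)$ is the set of these (configurations of distinct permutations are distinct; an increasing permutation, including the empty one, has exactly one, with no hooks); $\mathrm{VHC}(A)=\bigcup_{\pi\in A}\mathrm{VHC}(\pi)$. -}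

module Defs where

open import Data.Nat.Base using (ℕ; zero; suc; pred; _≡ᵇ_; _<ᵇ_; _≤ᵇ_)
open import Data.Bool.Base using (Bool; true; false; _∧_; _∨_; not; _xor_)
open import Data.List.Base
  using (List; []; _∷_; [_]; _++_; map; concatMap; zipWith; filterᵇ; length; all; any)
open import Data.Nat.ListAction using (sum)
open import Data.Product.Base using (_×_; _,_)

-- Conventions: a permutation π ∈ S_n is the word π₁⋯πₙ, encoded as a
-- List ℕ of length n whose entries are exactly 1,…,n.  Positions are 1-based.

range : ℕ → List ℕ
range zero    = []
range (suc n) = range n ++ [ suc n ]

count : {A : Set} → (A → Bool) → List A → ℕ
count p xs = length (filterᵇ p xs)

words : List ℕ → ℕ → List (List ℕ)
words as zero    = [ [] ]
words as (suc k) = concatMap (λ a → map (a ∷_) (words as k)) as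

-- 1-based entry π_i (0 if out of range; never used out of range)
at : List ℕ → ℕ → ℕ
at []       _             = 0
at (x ∷ xs) zero          = 0
at (x ∷ xs) (suc zero)    = x
at (x ∷ xs) (suc (suc i)) = at xs (suc i)

-- a word of length n over [1..n] is a permutation iff each value occurs once
isPerm : ℕ → List ℕ → Bool
isPerm n w = all (λ v → count (v ≡ᵇ_) w ≡ᵇ 1) (range n)

S : ℕ → List (List ℕ)
S n = filterᵇ (isPerm n) (words (range n) n)

subseqs : ℕ → List ℕ → List (List ℕ)
subseqs zero    _        = [ [] ]
subseqs (suc k) []       = []
subseqs (suc k) (x ∷ xs) = map (x ∷_) (subseqs k xs) ++ subseqs (suc k) xs

_⇔ᵇ_ : Bool → Bool → Bool
a ⇔ᵇ b = not (a xor b)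

sameOrder : List ℕ → List ℕ → Bool
sameOrder p s =
  all (λ a → all (λ b → (at p a <ᵇ at p b) ⇔ᵇ (at s a <ᵇ at s b)) idx) idx
  where idx = range (length p)

contains : List ℕ → List ℕ → Bool
contains p π = any (sameOrder p) (subseqs (length p) π)

avoids132-321 : List ℕ → Bool
avoids132-321 π =
  not (contains (1 ∷ 3 ∷ 2 ∷ []) π) ∧ not (contains (3 ∷ 2 ∷ 1 ∷ []) π)

Av132-321 : ℕ → List (List ℕ)
Av132-321 n = filterᵇ avoids132-321 (S n)

descents : List ℕ → List ℕ
descents π = filterᵇ (λ i → at π (suc i) <ᵇ at π i) (range (pred (length π)))

Point : Set
Point = ℕ × ℕ

-- a hook is given by the pair (i , j) of positions
Hook : Set
Hook = ℕ × ℕ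

_==ᴾ_ : Point → Point → Bool
(x , y) ==ᴾ (x' , y') = (x ≡ᵇ x') ∧ (y ≡ᵇ y')

SW NE : List ℕ → Hook → Point
SW π (i , j) = (i , at π i)
NE π (i , j) = (j , at π j)

isHook : List ℕ → Hook → Bool
isHook π (i , j) = (i <ᵇ j) ∧ (j ≤ᵇ length π) ∧ (at π i <ᵇ at π j)

-- the (integer) point (x , y) lies on the hook: on the vertical segment
-- from (i,π_i) to (i,π_j) or on the horizontal segment from (i,π_j) to (j,π_j).
-- (All endpoints are integral and the segments axis-parallel, so two hooks
-- meet as subsets of ℝ² iff they share an integer point.)
onHook : List ℕ → Hook → Point → Bool
onHook π (i , j) (x , y) =
  ((x ≡ᵇ i) ∧ (at π i ≤ᵇ y) ∧ (y ≤ᵇ at π j))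
  ∨ ((y ≡ᵇ at π j) ∧ (i ≤ᵇ x) ∧ (x ≤ᵇ j))

nothingAbove : List ℕ → Hook → Bool
nothingAbove π (i , j) =
  all (λ k → not ((i <ᵇ k) ∧ (k <ᵇ j) ∧ (at π j <ᵇ at π k))) (range (length π))

-- the grid [n] × [n] containing every hook of π ∈ S_n
grid : ℕ → List Point
grid n = concatMap (λ x → map (x ,_) (range n)) (range n)

compatible : List ℕ → Hook → Hook → Bool
compatible π H H' =
  all (λ P → not (onHook π H P ∧ onHook π H' P)
             ∨ ((P ==ᴾ NE π H) ∧ (P ==ᴾ SW π H'))
             ∨ ((P ==ᴾ NE π H') ∧ (P ==ᴾ SW π H)))
      (grid (length π))

allPairs : {A : Set} → (A → A → Bool) → List A → Bool
allPairs p []       = true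
allPairs p (x ∷ xs) = all (p x) xs ∧ allPairs p xs

-- a configuration is given by the northeast x-coordinates (j₁,…,j_k) of
-- the hooks H_t = (d_t , j_t); condition (1) is built in
hooksOf : List ℕ → List ℕ → List Hook
hooksOf π js = zipWith _,_ (descents π) js

isVHC : List ℕ → List ℕ → Bool
isVHC π js =
  all (isHook π) hs ∧ all (nothingAbove π) hs ∧ allPairs (compatible π) hs
  where hs = hooksOf π js

numVHC : List ℕ → ℕ
numVHC π = count (isVHC π) (words (range (length π)) (length (descents π)))

numVHCAv : ℕ → ℕ
numVHCAv n = sum (map numVHC (Av132-321 n))

-- Av_n(132,321) consists of the identity and, for a, b ≥ 1 with a + b ≤ n, the permutations
-- a+1 … a+b 1 … a a+b+1 … n.  Avoiding 321 makes the entries before the entry 1 increase, and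
-- avoiding 132 makes the entries from the 1 on increase and forces the values before the 1 to be
-- consecutive; the values from the 1 on are then the remaining ones in increasing order.
-- The identity has no descent and hence exactly one (empty) hook configuration.  The other
-- permutations have the single descent b, with π_b = a + b, and its hook can end exactly at the
-- positions j > a + b, which gives n − a − b configurations.  Altogether the count is
-- 1 + Σ_{a,b ≥ 1} (n − a − b) = 1 + C(n,3) = C(n+3,3) − 3 C(n+2,3) + 3 C(n+1,3).
--
-- Since S_n is a filtered list of words, the sum over Av_n(132,321) is reindexed by the explicit
-- list of these permutations: each occurs exactly once among the words, and each word in
-- Av_n(132,321) occurs exactly once in the list.

{-# OPTIONS --safe #-}
module Submission where

open import Defs
open import Data.Nat.Base using (ℕ; _+_)
open import Data.Nat.Combinatorics using (_C_)
open import Data.Integer.Base as ℤ using (ℤ; +_)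
open import Relation.Binary.PropositionalEquality using (_≡_)

open import Data.Bool.Base using (Bool; true; false; T; not; _∧_; if_then_else_)
open import Data.Bool.ListAction using (all)
open import Data.Bool.Properties using (T-≡; T-∧; ¬-not; ∧-identityʳ)
open import Data.Empty using (⊥; ⊥-elim)
import Data.Integer.Properties as ℤ
open import Data.Integer.Tactic.RingSolver using () renaming (solve-∀ to solve-∀-ℤ)
open import Data.List.Base using (List; []; _∷_; [_]; _++_; map; concatMap; filterᵇ; length; applyUpTo; zipWith)
open import Data.List.Instances
open import Data.List.Membership.Propositional using (_∈_; _∉_; find; lose)
open import Data.List.Membership.Propositional.Properties
  using (∈-applyUpTo⁺; ∈-applyUpTo⁻; ∈-concatMap⁻; ∈-filter⁻; ∈-map⁺; ∈-map⁻; ∈-++⁺ˡ; ∈-++⁺ʳ; ∈-++⁻)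
open import Data.List.Properties
  using (map-++; map-∘; ∷-injective; ∷-injectiveˡ; applyUpTo-∷ʳ; length-applyUpTo; filter-++; filter-none; filter-accept; filter-reject)
open import Data.List.Relation.Unary.All as All using (All)
open import Data.List.Relation.Unary.All.Properties using (all⁺; all⁻)
open import Data.List.Relation.Unary.Any using (here; there)
open import Data.List.Relation.Unary.Any.Properties using (any⁺; any⁻)
open import Data.Nat.Base
  using (suc; zero; pred; _*_; _∸_; _≤_; _<_; z≤n; s≤s; z<s; s<s; s<s⁻¹; s≤s⁻¹; _≡ᵇ_; _<ᵇ_; _≤ᵇ_; >-nonZero)
open import Data.Nat.Combinatorics using (nCk+nC[k+1]≡[n+1]C[k+1]; nC1≡n)
open import Data.Nat.Instances
open import Data.Nat.ListAction using (sum)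
open import Data.Nat.ListAction.Properties using (sum-++)
open import Data.Nat.Properties hiding (_≟_)
open import Algebra.Properties.CommutativeSemigroup +-commutativeSemigroup using (interchange)
open import Data.Nat.Tactic.RingSolver using (solve-∀)
open import Data.Product.Base using (_×_; _,_; proj₁; proj₂; ∃-syntax; uncurry)
open import Data.Product.Instances
open import Data.Product.Properties using (,-injective)
open import Data.Sum.Base using (_⊎_; inj₁; inj₂)
open import Function.Base using (_∘_)
open import Function.Bundles using (Equivalence; _⇔_; mk⇔)
open import Relation.Binary.Definitions using (DecidableEquality; tri<; tri≈; tri>)
open import Relation.Binary.PropositionalEquality using (refl; sym; trans; cong; cong₂; subst; subst₂; _≢_; module ≡-Reasoning)
open import Relation.Binary.Structures using (IsDecEquivalence)
open import Relation.Nullary using (¬_; yes; no)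
open import Relation.Nullary.Decidable using (does; dec-true; dec-false; T?)

private variable A B D : Set

module _ {m n : ℕ} where

  <⇒<ᵇ≡true : m < n → (m <ᵇ n) ≡ true
  <⇒<ᵇ≡true = Equivalence.to T-≡ ∘ <⇒<ᵇ

  ≥⇒<ᵇ≡false : n ≤ m → (m <ᵇ n) ≡ false
  ≥⇒<ᵇ≡false n≤m = ¬-not (≤⇒≯ n≤m ∘ <ᵇ⇒< m n ∘ Equivalence.from T-≡)

  ≤⇒≤ᵇ≡true : m ≤ n → (m ≤ᵇ n) ≡ true
  ≤⇒≤ᵇ≡true = Equivalence.to T-≡ ∘ ≤⇒≤ᵇ

  >⇒≤ᵇ≡false : n < m → (m ≤ᵇ n) ≡ false
  >⇒≤ᵇ≡false n<m = ¬-not (<⇒≱ n<m ∘ ≤ᵇ⇒≤ m n ∘ Equivalence.from T-≡)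

T-not⁺ : ∀ {b} → ¬ T b → T (not b)
T-not⁺ {false} _  = _
T-not⁺ {true}  ¬b = ¬b _

T-not⁻ : ∀ {b} → T (not b) → ¬ T b
T-not⁻ {false} _ ()

T-true⇔ᵇ : ∀ {b} → T (true ⇔ᵇ b) → T b
T-true⇔ᵇ {true} _ = _

T-not-∧₃ : ∀ {x y z} → (T x → T y → T z → ⊥) → T (not (x ∧ y ∧ z))
T-not-∧₃ {x} {y} ¬xyz = T-not⁺ λ xyz →
  let tx , tyz = Equivalence.to (T-∧ {x}) xyz ; ty , tz = Equivalence.to (T-∧ {y}) tyz in ¬xyz tx ty tz

𝟙 : Bool → ℕ
𝟙 b = if b then 1 else 0

𝟙-T : ∀ {b} → T b → 𝟙 b ≡ 1
𝟙-T {true} _ = refl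

𝟙-cong : ∀ {x y} → (T x → T y) → (T y → T x) → 𝟙 x ≡ 𝟙 y
𝟙-cong {false} {false} _ _ = refl
𝟙-cong {false} {true}  _ y⇒x = ⊥-elim (y⇒x _)
𝟙-cong {true}  {false} x⇒y _ = ⊥-elim (x⇒y _)
𝟙-cong {true}  {true}  _ _ = refl

-- Finite sums and multiplicities

∑ : List A → (A → ℕ) → ℕ
∑ xs f = sum (map f xs)

syntax ∑ xs (λ x → e) = ∑[ x ∈ xs ] e

∑-++ : ∀ xs ys (f : A → ℕ) → ∑ (xs ++ ys) f ≡ ∑ xs f + ∑ ys f
∑-++ xs ys f = trans (cong sum (map-++ f xs ys)) (sum-++ (map f xs) (map f ys))

∑-cong : ∀ xs {f g : A → ℕ} → (∀ {x} → x ∈ xs → f x ≡ g x) → ∑ xs f ≡ ∑ xs g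
∑-cong []       f≡g = refl
∑-cong (x ∷ xs) f≡g = cong₂ _+_ (f≡g (here refl)) (∑-cong xs (f≡g ∘ there))

∑-zero : ∀ xs {f : A → ℕ} → (∀ {x} → x ∈ xs → f x ≡ 0) → ∑ xs f ≡ 0
∑-zero []       f≡0 = refl
∑-zero (x ∷ xs) f≡0 = cong₂ _+_ (f≡0 (here refl)) (∑-zero xs (f≡0 ∘ there))

∑-+ : ∀ xs (f g : A → ℕ) → ∑[ x ∈ xs ] (f x + g x) ≡ ∑ xs f + ∑ xs g
∑-+ []       f g = refl
∑-+ (x ∷ xs) f g = trans (cong (_+_ (f x + g x)) (∑-+ xs f g)) (interchange (f x) (g x) _ _)

∑-*ˡ : ∀ xs c (f : A → ℕ) → ∑[ x ∈ xs ] (c * f x) ≡ c * ∑ xs f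
∑-*ˡ []       c f = sym (*-zeroʳ c)
∑-*ˡ (x ∷ xs) c f = trans (cong (_+_ (c * f x)) (∑-*ˡ xs c f)) (sym (*-distribˡ-+ c (f x) (∑ xs f)))

∑-*ʳ : ∀ xs (f : A → ℕ) c → ∑[ x ∈ xs ] (f x * c) ≡ ∑ xs f * c
∑-*ʳ xs f c = begin
  ∑[ x ∈ xs ] (f x * c) ≡⟨ ∑-cong xs (λ {x} _ → *-comm (f x) c) ⟩
  ∑[ x ∈ xs ] (c * f x) ≡⟨ ∑-*ˡ xs c f ⟩
  c * ∑ xs f            ≡⟨ *-comm c (∑ xs f) ⟩
  ∑ xs f * c            ∎
  where open ≡-Reasoning

∑-filterᵇ : ∀ (p : A → Bool) xs (f : A → ℕ) → ∑ (filterᵇ p xs) f ≡ ∑[ x ∈ xs ] (𝟙 (p x) * f x)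
∑-filterᵇ p []       f = refl
∑-filterᵇ p (x ∷ xs) f with p x
... | true  = cong₂ _+_ (sym (+-identityʳ (f x))) (∑-filterᵇ p xs f)
... | false = ∑-filterᵇ p xs f

count≡∑ : ∀ (p : A → Bool) xs → count p xs ≡ ∑[ x ∈ xs ] 𝟙 (p x)
count≡∑ p []       = refl
count≡∑ p (x ∷ xs) with p x
... | true  = cong suc (count≡∑ p xs)
... | false = count≡∑ p xs

∑-map : ∀ (g : A → B) xs (f : B → ℕ) → ∑ (map g xs) f ≡ ∑[ x ∈ xs ] f (g x)
∑-map g xs f = cong sum (sym (map-∘ {g = f} {f = g} xs))

∑-concatMap : ∀ (g : A → List B) xs (f : B → ℕ) → ∑ (concatMap g xs) f ≡ ∑[ x ∈ xs ] ∑ (g x) f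
∑-concatMap g []       f = refl
∑-concatMap g (x ∷ xs) f = trans (∑-++ (g x) (concatMap g xs) f) (cong (_+_ (∑ (g x) f)) (∑-concatMap g xs f))

∑-swap : ∀ xs (ys : List B) (f : A → B → ℕ) → ∑[ x ∈ xs ] ∑[ y ∈ ys ] f x y ≡ ∑[ y ∈ ys ] ∑[ x ∈ xs ] f x y
∑-swap []       ys f = sym (∑-zero ys (λ _ → refl))
∑-swap (x ∷ xs) ys f = trans (cong (_+_ (∑ ys (f x))) (∑-swap xs ys f)) (sym (∑-+ ys (f x) _))

∑-range-suc : ∀ n (f : ℕ → ℕ) → ∑ (range (suc n)) f ≡ ∑ (range n) f + f (suc n)
∑-range-suc n f = trans (∑-++ (range n) [ suc n ] f) (cong (_+_ (∑ (range n) f)) (+-identityʳ (f (suc n))))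

∑-range-<ᵇ : ∀ n c → ∑[ j ∈ range n ] 𝟙 (c <ᵇ j) ≡ n ∸ c
∑-range-<ᵇ zero    c = sym (0∸n≡0 c)
∑-range-<ᵇ (suc n) c with c ≤? n
... | yes c≤n rewrite ∑-range-suc n (λ j → 𝟙 (c <ᵇ j)) | ∑-range-<ᵇ n c | <⇒<ᵇ≡true (s≤s c≤n) =
  trans (+-comm (n ∸ c) 1) (sym (+-∸-assoc 1 c≤n))
... | no c≰n rewrite ∑-range-suc n (λ j → 𝟙 (c <ᵇ j)) | ∑-range-<ᵇ n c | ≥⇒<ᵇ≡false (≰⇒> c≰n)
                   | m≤n⇒m∸n≡0 (<⇒≤ (≰⇒> c≰n)) | m≤n⇒m∸n≡0 (≰⇒> c≰n) = refl

DecEq : Set → Set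
DecEq A = IsDecEquivalence {A = A} _≡_

_≟_ : {{DecEq A}} → DecidableEquality A
_≟_ {{isDecEquivalence}} = IsDecEquivalence._≟_ isDecEquivalence

δ : {{DecEq A}} → A → A → ℕ
δ x y = 𝟙 (does (x ≟ y))

multiplicity : {{DecEq A}} → A → List A → ℕ
multiplicity x xs = ∑[ y ∈ xs ] δ x y

module _ {{_ : DecEq A}} where

  δ-refl : ∀ (x : A) → δ x x ≡ 1
  δ-refl x = cong 𝟙 (dec-true (x ≟ x) refl)

  δ-≢ : ∀ {x y : A} → x ≢ y → δ x y ≡ 0
  δ-≢ {x} {y} x≢y = cong 𝟙 (dec-false (x ≟ y) x≢y)

  δ-sym : ∀ (x y : A) → δ x y ≡ δ y x
  δ-sym x y with x ≟ y
  ... | yes refl = sym (δ-refl x)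
  ... | no x≢y   = sym (δ-≢ (x≢y ∘ sym))

  ∑-δ : ∀ xs (x : A) (f : A → ℕ) → ∑[ y ∈ xs ] (δ x y * f y) ≡ multiplicity x xs * f x
  ∑-δ []       x f = refl
  ∑-δ (y ∷ xs) x f with x ≟ y
  ... | yes refl = cong₂ _+_ (*-identityˡ (f x)) (∑-δ xs x f)
  ... | no _     = ∑-δ xs x f

  multiplicity-∉ : ∀ {x : A} xs → x ∉ xs → multiplicity x xs ≡ 0
  multiplicity-∉ xs x∉xs = ∑-zero xs (λ y∈xs → δ-≢ (λ { refl → x∉xs y∈xs }))

  ∈⇒0<multiplicity : ∀ {x : A} {xs} → x ∈ xs → 0 < multiplicity x xs
  ∈⇒0<multiplicity {x} {_ ∷ xs} (here refl) = subst (λ d → 0 < d + multiplicity x xs) (sym (δ-refl x)) z<s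
  ∈⇒0<multiplicity {x} {y ∷ _} (there x∈xs) = <-≤-trans (∈⇒0<multiplicity x∈xs) (m≤n+m _ (δ x y))

  0<multiplicity⇒∈ : ∀ {x : A} xs → 0 < multiplicity x xs → x ∈ xs
  0<multiplicity⇒∈ {x} (y ∷ xs) 0<m with x ≟ y
  ... | yes refl = here refl
  ... | no _     = there (0<multiplicity⇒∈ xs 0<m)

  multiplicity-∷ : ∀ {x y : A} {xs} → multiplicity x (y ∷ xs) ≡ 1 → x ∈ xs → x ≢ y × multiplicity x xs ≡ 1
  multiplicity-∷ {x} {y} once x∈xs with x ≟ y
  ... | yes refl = ⊥-elim (<⇒≢ (∈⇒0<multiplicity x∈xs) (sym (suc-injective once)))
  ... | no x≢y   = x≢y , once

  multiplicity-filterᵇ : ∀ (p : A → Bool) {x : A} → T (p x) → ∀ xs →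
                         multiplicity x (filterᵇ p xs) ≡ multiplicity x xs
  multiplicity-filterᵇ p px []       = refl
  multiplicity-filterᵇ p {x} px (y ∷ xs) with p y in py
  ... | true  = cong (_+_ (δ x y)) (multiplicity-filterᵇ p px xs)
  ... | false = trans (multiplicity-filterᵇ p px xs) (cong (_+ multiplicity x xs) (sym (δ-≢ λ { refl → subst T py px })))

  ∑-filterᵇ-enumeration : ∀ (P : A → Bool) (xs ys : List A) (f : A → ℕ) →
    (∀ {y} → y ∈ ys → T (P y) × multiplicity y xs ≡ 1) →
    (∀ {x} → x ∈ xs → T (P x) → multiplicity x ys ≡ 1) →
    ∑ (filterᵇ P xs) f ≡ ∑ ys f
  ∑-filterᵇ-enumeration P xs ys f enumerated complete = begin
    ∑ (filterᵇ P xs) f                           ≡⟨ ∑-filterᵇ P xs f ⟩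
    ∑[ x ∈ xs ] g x                              ≡⟨ ∑-cong xs counted-once ⟩
    ∑[ x ∈ xs ] ∑[ y ∈ ys ] (δ y x * g x)        ≡⟨ ∑-swap xs ys (λ x y → δ y x * g x) ⟩
    ∑[ y ∈ ys ] ∑[ x ∈ xs ] (δ y x * g x)        ≡⟨ ∑-cong ys (λ {y} _ → ∑-δ xs y g) ⟩
    ∑[ y ∈ ys ] (multiplicity y xs * g y)        ≡⟨ ∑-cong ys enumerated-once ⟩
    ∑ ys f                                       ∎
    where
    open ≡-Reasoning
    g : A → ℕ
    g x = 𝟙 (P x) * f x

    counted-once : ∀ {x} → x ∈ xs → g x ≡ ∑[ y ∈ ys ] (δ y x * g x)
    counted-once {x} x∈xs = begin
      g x                            ≡⟨ weight ⟩
      multiplicity x ys * g x        ≡⟨ ∑-*ʳ ys (δ x) (g x) ⟨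
      ∑[ y ∈ ys ] (δ x y * g x)      ≡⟨ ∑-cong ys (λ {y} _ → cong (_* g x) (δ-sym x y)) ⟩
      ∑[ y ∈ ys ] (δ y x * g x)      ∎
      where
      weight : g x ≡ multiplicity x ys * g x
      weight with P x in Px
      ... | true  = sym (trans (cong (_* (f x + 0)) (complete x∈xs (Equivalence.from T-≡ Px))) (+-identityʳ _))
      ... | false = sym (*-zeroʳ (multiplicity x ys))

    enumerated-once : ∀ {y} → y ∈ ys → multiplicity y xs * g y ≡ f y
    enumerated-once {y} y∈ys
      rewrite proj₂ (enumerated y∈ys) | 𝟙-T (proj₁ (enumerated y∈ys)) = trans (+-identityʳ _) (+-identityʳ (f y))

multiplicity-map : {{_ : DecEq A}} {{_ : DecEq B}} (f : A → B) {x : A} (xs : List A) →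
                   (∀ {y} → y ∈ xs → f x ≡ f y → x ≡ y) →
                   multiplicity (f x) (map f xs) ≡ multiplicity x xs
multiplicity-map f {x} xs f-injective = trans (∑-map f xs (δ (f x))) (∑-cong xs δ-f)
  where
  δ-f : ∀ {y} → y ∈ xs → δ (f x) (f y) ≡ δ x y
  δ-f {y} y∈xs with x ≟ y
  ... | yes refl = δ-refl (f x)
  ... | no x≢y   = δ-≢ (x≢y ∘ f-injective y∈xs)

module _ {{_ : DecEq A}} {{_ : DecEq B}} {{_ : DecEq D}} (g : A → B → D)
         (g-injective : ∀ {a a' b b'} → g a b ≡ g a' b' → a ≡ a' × b ≡ b') where

  δ-injective₂ : ∀ (a a' : A) (b b' : B) → δ (g a b) (g a' b') ≡ δ a a' * δ b b'
  δ-injective₂ a a' b b' with a ≟ a' | b ≟ b'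
  ... | yes refl | yes refl = δ-refl (g a b)
  ... | no a≢a'  | _        = δ-≢ (a≢a' ∘ proj₁ ∘ g-injective)
  ... | yes _    | no b≢b'  = δ-≢ (b≢b' ∘ proj₂ ∘ g-injective)

  multiplicity-concatMap-map : ∀ as (h : A → List B) (a : A) (b : B) →
    multiplicity (g a b) (concatMap (λ a' → map (g a') (h a')) as) ≡ multiplicity a as * multiplicity b (h a)
  multiplicity-concatMap-map as h a b = begin
    multiplicity (g a b) (concatMap (λ a' → map (g a') (h a')) as)
      ≡⟨ ∑-concatMap (λ a' → map (g a') (h a')) as (δ (g a b)) ⟩
    ∑[ a' ∈ as ] multiplicity (g a b) (map (g a') (h a'))
      ≡⟨ ∑-cong as (λ {a'} _ → ∑-map (g a') (h a') (δ (g a b))) ⟩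
    ∑[ a' ∈ as ] ∑[ b' ∈ h a' ] δ (g a b) (g a' b')
      ≡⟨ ∑-cong as (λ {a'} _ → ∑-cong (h a') (λ {b'} _ → δ-injective₂ a a' b b')) ⟩
    ∑[ a' ∈ as ] ∑[ b' ∈ h a' ] (δ a a' * δ b b')
      ≡⟨ ∑-cong as (λ {a'} _ → ∑-*ˡ (h a') (δ a a') (δ b)) ⟩
    ∑[ a' ∈ as ] (δ a a' * multiplicity b (h a'))
      ≡⟨ ∑-δ as a (λ a' → multiplicity b (h a')) ⟩
    multiplicity a as * multiplicity b (h a) ∎
    where open ≡-Reasoning

range≡applyUpTo : ∀ n → range n ≡ applyUpTo suc n
range≡applyUpTo zero    = refl
range≡applyUpTo (suc n) = trans (cong (_++ [ suc n ]) (range≡applyUpTo n)) (applyUpTo-∷ʳ suc n)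

∈-range⁻ : ∀ {n x} → x ∈ range n → 0 < x × x ≤ n
∈-range⁻ {n} x∈range with i , i<n , refl ← ∈-applyUpTo⁻ suc (subst (_ ∈_) (range≡applyUpTo n) x∈range) = z<s , i<n

∈-range⁺ : ∀ {n x} → 0 < x → x ≤ n → x ∈ range n
∈-range⁺ {n} {suc i} _ i<n = subst (suc i ∈_) (sym (range≡applyUpTo n)) (∈-applyUpTo⁺ suc i<n)

multiplicity-applyUpTo : {{_ : DecEq A}} (f : ℕ → A) (n : ℕ) {i₀ : ℕ} → i₀ < n →
                         (∀ {i} → i < n → f i ≡ f i₀ → i ≡ i₀) → multiplicity (f i₀) (applyUpTo f n) ≡ 1
multiplicity-applyUpTo f (suc n) {zero} _ unique = cong₂ _+_ (δ-refl (f 0)) (multiplicity-∉ _ f0∉)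
  where
  f0∉ : f 0 ∉ applyUpTo (f ∘ suc) n
  f0∉ f0∈ with i , i<n , f0≡ ← ∈-applyUpTo⁻ (f ∘ suc) f0∈ with () ← unique (s≤s i<n) (sym f0≡)
multiplicity-applyUpTo f (suc n) {suc i₀} (s≤s i₀<n) unique =
  cong₂ _+_ (δ-≢ f0≢) (multiplicity-applyUpTo (f ∘ suc) n i₀<n (λ i<n → suc-injective ∘ unique (s≤s i<n)))
  where
  f0≢ : f (suc i₀) ≢ f 0
  f0≢ eq with () ← unique z<s (sym eq)

multiplicity-range : ∀ {n x} → 0 < x → x ≤ n → multiplicity x (range n) ≡ 1
multiplicity-range {n} {suc i} _ i<n rewrite range≡applyUpTo n = multiplicity-applyUpTo suc n i<n (λ _ → suc-injective)

∈-words⁻ : ∀ as k {w} → w ∈ words as k → length w ≡ k × (∀ {x} → x ∈ w → x ∈ as)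
∈-words⁻ as zero    (here refl) = refl , λ ()
∈-words⁻ as (suc k) w∈words
  with a , a∈as , w∈map ← find (∈-concatMap⁻ (λ a → map (a ∷_) (words as k)) {xs = as} w∈words)
  with w' , w'∈words , refl ← ∈-map⁻ (a ∷_) w∈map
  with len≡ , entries ← ∈-words⁻ as k w'∈words
  = cong suc len≡ , λ { (here refl) → a∈as ; (there x∈w') → entries x∈w' }

multiplicity-words : ∀ as (w : List ℕ) → (∀ {x} → x ∈ w → multiplicity x as ≡ 1) →
                     multiplicity w (words as (length w)) ≡ 1
multiplicity-words as []      _    = refl
multiplicity-words as (x ∷ w) once = begin
  multiplicity (x ∷ w) (words as (suc (length w)))
    ≡⟨ multiplicity-concatMap-map _∷_ ∷-injective as (λ _ → words as (length w)) x w ⟩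
  multiplicity x as * multiplicity w (words as (length w))
    ≡⟨ cong₂ _*_ (once (here refl)) (multiplicity-words as w (once ∘ there)) ⟩
  1 ∎
  where open ≡-Reasoning

filterᵇ-range-≡[_] : ∀ (p : ℕ → Bool) m {c} → c ∈ range m → (∀ {i} → i ∈ range m → T (p i) ⇔ i ≡ c) →
                     filterᵇ p (range m) ≡ [ c ]
filterᵇ-range-≡[_] p (suc m) {c} c∈range p⇔≡c =
  trans (filter-++ (T? ∘ p) (range m) [ suc m ]) (split (∈-++⁻ (range m) c∈range))
  where
  p⇔≡c-last : T (p (suc m)) ⇔ suc m ≡ c
  p⇔≡c-last = p⇔≡c (∈-++⁺ʳ (range m) (here refl))

  split : c ∈ range m ⊎ c ∈ [ suc m ] → filterᵇ p (range m) ++ filterᵇ p [ suc m ] ≡ [ c ]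
  split (inj₂ (here refl)) = cong₂ _++_
    (filter-none (T? ∘ p) (All.tabulate λ i∈range pi →
      <⇒≢ (s≤s (proj₂ (∈-range⁻ i∈range))) (Equivalence.to (p⇔≡c (∈-++⁺ˡ i∈range)) pi)))
    (filter-accept (T? ∘ p) (Equivalence.from p⇔≡c-last refl))
  split (inj₁ c∈range') = cong₂ _++_
    (filterᵇ-range-≡[ p ] m c∈range' (p⇔≡c ∘ ∈-++⁺ˡ))
    (filter-reject (T? ∘ p) λ p-last → <⇒≢ (s≤s (proj₂ (∈-range⁻ c∈range'))) (sym (Equivalence.to p⇔≡c-last p-last)))

-- 0-based, whereas Defs.at is 1-based
_!_ : List ℕ → ℕ → ℕ
w ! i = at w (suc i)

!-applyUpTo : ∀ f n {i} → i < n → applyUpTo f n ! i ≡ f i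
!-applyUpTo f (suc n) {zero}  _          = refl
!-applyUpTo f (suc n) {suc i} (s≤s i<n) = !-applyUpTo (f ∘ suc) n i<n

!-ext : ∀ w {n f} → length w ≡ n → (∀ {i} → i < n → w ! i ≡ f i) → w ≡ applyUpTo f n
!-ext []      {zero}  _      _     = refl
!-ext (x ∷ w) {suc n} len≡ w≡f = cong₂ _∷_ (w≡f z<s) (!-ext w (suc-injective len≡) (w≡f ∘ s≤s))

!-∈ : ∀ w {i} → i < length w → w ! i ∈ w
!-∈ (x ∷ w) {zero}  _          = here refl
!-∈ (x ∷ w) {suc i} (s≤s i<n) = there (!-∈ w i<n)

∈⇒! : ∀ w {x} → x ∈ w → ∃[ i ] i < length w × w ! i ≡ x
∈⇒! (x ∷ w) (here refl) = 0 , z<s , refl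
∈⇒! (y ∷ w) (there x∈w) with i , i<n , wi≡x ← ∈⇒! w x∈w = suc i , s≤s i<n , wi≡x

!-injective : ∀ w {i j} → i < length w → j < length w → w ! i ≡ w ! j → multiplicity (w ! i) w ≡ 1 → i ≡ j
!-injective (y ∷ w) {zero}  {zero}  _          _          _   _    = refl
!-injective (y ∷ w) {zero}  {suc j} _          (s≤s j<n) y≡wj once =
  ⊥-elim (proj₁ (multiplicity-∷ once (subst (_∈ w) (sym y≡wj) (!-∈ w j<n))) refl)
!-injective (y ∷ w) {suc i} {zero}  (s≤s i<n) _          wi≡y once =
  ⊥-elim (proj₁ (multiplicity-∷ once (!-∈ w i<n)) wi≡y)
!-injective (y ∷ w) {suc i} {suc j} (s≤s i<n) (s≤s j<n) wi≡wj once =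
  cong suc (!-injective w i<n j<n wi≡wj (proj₂ (multiplicity-∷ once (!-∈ w i<n))))

-- Permutations and pattern avoidance

record IsPermutation (n : ℕ) (π : ℕ → ℕ) : Set where
  field
    bounded    : ∀ {i} → i < n → 0 < π i × π i ≤ n
    injective  : ∀ {i j} → i < n → j < n → π i ≡ π j → i ≡ j
    surjective : ∀ {v} → 0 < v → v ≤ n → ∃[ i ] i < n × π i ≡ v

isPerm⇒multiplicity≡1 : ∀ n w → T (isPerm n w) → ∀ {v} → v ∈ range n → multiplicity v w ≡ 1
isPerm⇒multiplicity≡1 n w perm v∈range =
  trans (sym (count≡∑ _ w)) (≡ᵇ⇒≡ _ 1 (All.lookup (all⁺ _ (range n) perm) v∈range))

isPerm⇒IsPermutation : ∀ {n w} → w ∈ words (range n) n → T (isPerm n w) → IsPermutation n (w !_)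
isPerm⇒IsPermutation {n} {w} w∈words perm = record
  { bounded    = ∈-range⁻ ∘ entry∈range
  ; injective  = λ i<n j<n wi≡wj → !-injective w (index i<n) (index j<n) wi≡wj (once (entry∈range i<n))
  ; surjective = surjective
  }
  where
  len≡ : length w ≡ n
  len≡ = proj₁ (∈-words⁻ (range n) n w∈words)
  once : ∀ {v} → v ∈ range n → multiplicity v w ≡ 1
  once = isPerm⇒multiplicity≡1 n w perm
  index : ∀ {i} → i < n → i < length w
  index = subst (_ <_) (sym len≡)
  entry∈range : ∀ {i} → i < n → w ! i ∈ range n
  entry∈range i<n = proj₂ (∈-words⁻ (range n) n w∈words) (!-∈ w (index i<n))
  surjective : ∀ {v} → 0 < v → v ≤ n → ∃[ i ] i < n × w ! i ≡ v
  surjective 0<v v≤n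
    with i , i<len , wi≡v ← ∈⇒! w (0<multiplicity⇒∈ w (subst (0 <_) (sym (once (∈-range⁺ 0<v v≤n))) z<s))
    = i , subst (i <_) len≡ i<len , wi≡v

IsPermutation⇒isPerm : ∀ {n f} → IsPermutation n f → T (isPerm n (applyUpTo f n))
IsPermutation⇒isPerm {n} {f} perm = all⁻ _ (All.tabulate once)
  where
  open IsPermutation perm
  once : ∀ {v} → v ∈ range n → T (count (v ≡ᵇ_) (applyUpTo f n) ≡ᵇ 1)
  once {v} v∈range with i₀ , i₀<n , refl ← surjective (proj₁ (∈-range⁻ {n} v∈range)) (proj₂ (∈-range⁻ {n} v∈range)) =
    ≡⇒≡ᵇ _ 1 (trans (count≡∑ _ (applyUpTo f n)) (multiplicity-applyUpTo f n i₀<n (λ i<n → injective i<n i₀<n)))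

Pattern : Set₁
Pattern = ℕ → ℕ → ℕ → Set

Order132 Order321 : Pattern
Order132 x y z = x < z × z < y
Order321 x y z = z < y × y < x

Avoids : Pattern → (ℕ → ℕ) → ℕ → Set
Avoids P π n = ∀ {i j k} → i < j → j < k → k < n → ¬ P (π i) (π j) (π k)

Avoids-applyUpTo : ∀ {P f n} → Avoids P f n → Avoids P (applyUpTo f n !_) (length (applyUpTo f n))
Avoids-applyUpTo {P} {f} {n} avoids {i} {j} {k} i<j j<k k<len
  rewrite length-applyUpTo f n
        | !-applyUpTo f n (<-trans i<j (<-trans j<k k<len))
        | !-applyUpTo f n (<-trans j<k k<len)
        | !-applyUpTo f n k<len = avoids i<j j<k k<len

_!₃_ : List ℕ → ℕ × ℕ × ℕ → List ℕ
w !₃ (i , j , k) = w ! i ∷ w ! j ∷ w ! k ∷ []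

∈-subseqs₁⁺ : ∀ w {i} → i < length w → (w ! i ∷ []) ∈ subseqs 1 w
∈-subseqs₁⁺ (x ∷ w) {zero}  _          = here refl
∈-subseqs₁⁺ (x ∷ w) {suc i} (s≤s i<n) = ∈-++⁺ʳ _ (∈-subseqs₁⁺ w i<n)

∈-subseqs₂⁺ : ∀ w {i j} → i < j → j < length w → (w ! i ∷ w ! j ∷ []) ∈ subseqs 2 w
∈-subseqs₂⁺ (x ∷ w) {zero}  {suc j} _          (s≤s j<n) = ∈-++⁺ˡ (∈-map⁺ (x ∷_) (∈-subseqs₁⁺ w j<n))
∈-subseqs₂⁺ (x ∷ w) {suc i} {suc j} (s≤s i<j) (s≤s j<n) = ∈-++⁺ʳ _ (∈-subseqs₂⁺ w i<j j<n)

∈-subseqs₃⁺ : ∀ w {i j k} → i < j → j < k → k < length w → w !₃ (i , j , k) ∈ subseqs 3 w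
∈-subseqs₃⁺ (x ∷ w) {zero}  {suc j} {suc k} _          (s≤s j<k) (s≤s k<n) = ∈-++⁺ˡ (∈-map⁺ (x ∷_) (∈-subseqs₂⁺ w j<k k<n))
∈-subseqs₃⁺ (x ∷ w) {suc i} {suc j} {suc k} (s≤s i<j) (s≤s j<k) (s≤s k<n) = ∈-++⁺ʳ _ (∈-subseqs₃⁺ w i<j j<k k<n)

∈-subseqs₁⁻ : ∀ w {s} → s ∈ subseqs 1 w → ∃[ i ] i < length w × s ≡ w ! i ∷ []
∈-subseqs₁⁻ (x ∷ w) s∈ with ∈-++⁻ (map (x ∷_) (subseqs 0 w)) s∈
... | inj₁ (here refl) = 0 , z<s , refl
... | inj₂ s∈w with i , i<n , refl ← ∈-subseqs₁⁻ w s∈w = suc i , s≤s i<n , refl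

∈-subseqs₂⁻ : ∀ w {s} → s ∈ subseqs 2 w → ∃[ i ] ∃[ j ] i < j × j < length w × s ≡ w ! i ∷ w ! j ∷ []
∈-subseqs₂⁻ (x ∷ w) s∈ with ∈-++⁻ (map (x ∷_) (subseqs 1 w)) s∈
... | inj₁ s∈map
  with s' , s'∈ , refl ← ∈-map⁻ (x ∷_) s∈map
  with j , j<n , refl ← ∈-subseqs₁⁻ w s'∈ = 0 , suc j , z<s , s≤s j<n , refl
... | inj₂ s∈w with i , j , i<j , j<n , refl ← ∈-subseqs₂⁻ w s∈w = suc i , suc j , s≤s i<j , s≤s j<n , refl

∈-subseqs₃⁻ : ∀ w {s} → s ∈ subseqs 3 w → ∃[ i ] ∃[ j ] ∃[ k ] i < j × j < k × k < length w × s ≡ w !₃ (i , j , k)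
∈-subseqs₃⁻ (x ∷ w) s∈ with ∈-++⁻ (map (x ∷_) (subseqs 2 w)) s∈
... | inj₁ s∈map
  with s' , s'∈ , refl ← ∈-map⁻ (x ∷_) s∈map
  with j , k , j<k , k<n , refl ← ∈-subseqs₂⁻ w s'∈ = 0 , suc j , suc k , z<s , s≤s j<k , s≤s k<n , refl
... | inj₂ s∈w with i , j , k , i<j , j<k , k<n , refl ← ∈-subseqs₃⁻ w s∈w =
  suc i , suc j , suc k , s≤s i<j , s≤s j<k , s≤s k<n , refl

sameOrder⁻ : ∀ p s {a b} → T (sameOrder p s) → a ∈ range (length p) → b ∈ range (length p) →
             T ((at p a <ᵇ at p b) ⇔ᵇ (at s a <ᵇ at s b))
sameOrder⁻ p s same a∈ b∈ = All.lookup (all⁺ _ _ (All.lookup (all⁺ _ _ same) a∈)) b∈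

p132 p321 : List ℕ
p132 = 1 ∷ 3 ∷ 2 ∷ []
p321 = 3 ∷ 2 ∷ 1 ∷ []

module _ {x y z : ℕ} where

  private
    1∈ : 1 ∈ range 3
    1∈ = here refl
    2∈ : 2 ∈ range 3
    2∈ = there (here refl)
    3∈ : 3 ∈ range 3
    3∈ = there (there (here refl))

  sameOrder-132⁻ : T (sameOrder p132 (x ∷ y ∷ z ∷ [])) → Order132 x y z
  sameOrder-132⁻ same = <ᵇ⇒< x z (T-true⇔ᵇ (sameOrder⁻ p132 (x ∷ y ∷ z ∷ []) same 1∈ 3∈))
                      , <ᵇ⇒< z y (T-true⇔ᵇ (sameOrder⁻ p132 (x ∷ y ∷ z ∷ []) same 3∈ 2∈))

  sameOrder-321⁻ : T (sameOrder p321 (x ∷ y ∷ z ∷ [])) → Order321 x y z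
  sameOrder-321⁻ same = <ᵇ⇒< z y (T-true⇔ᵇ (sameOrder⁻ p321 (x ∷ y ∷ z ∷ []) same 3∈ 2∈))
                      , <ᵇ⇒< y x (T-true⇔ᵇ (sameOrder⁻ p321 (x ∷ y ∷ z ∷ []) same 2∈ 1∈))

  sameOrder-132⁺ : Order132 x y z → T (sameOrder p132 (x ∷ y ∷ z ∷ []))
  sameOrder-132⁺ (x<z , z<y)
    rewrite ≥⇒<ᵇ≡false (≤-refl {x}) | ≥⇒<ᵇ≡false (≤-refl {y}) | ≥⇒<ᵇ≡false (≤-refl {z})
          | <⇒<ᵇ≡true x<z | <⇒<ᵇ≡true z<y | <⇒<ᵇ≡true (<-trans x<z z<y)
          | ≥⇒<ᵇ≡false (<⇒≤ x<z) | ≥⇒<ᵇ≡false (<⇒≤ z<y) | ≥⇒<ᵇ≡false (<⇒≤ (<-trans x<z z<y)) = _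

  sameOrder-321⁺ : Order321 x y z → T (sameOrder p321 (x ∷ y ∷ z ∷ []))
  sameOrder-321⁺ (z<y , y<x)
    rewrite ≥⇒<ᵇ≡false (≤-refl {x}) | ≥⇒<ᵇ≡false (≤-refl {y}) | ≥⇒<ᵇ≡false (≤-refl {z})
          | <⇒<ᵇ≡true y<x | <⇒<ᵇ≡true z<y | <⇒<ᵇ≡true (<-trans z<y y<x)
          | ≥⇒<ᵇ≡false (<⇒≤ y<x) | ≥⇒<ᵇ≡false (<⇒≤ z<y) | ≥⇒<ᵇ≡false (<⇒≤ (<-trans z<y y<x)) = _

module _ {p₁ p₂ p₃ : ℕ} (P : Pattern)
         (same⇒P : ∀ {x y z} → T (sameOrder (p₁ ∷ p₂ ∷ p₃ ∷ []) (x ∷ y ∷ z ∷ [])) → P x y z)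
         (P⇒same : ∀ {x y z} → P x y z → T (sameOrder (p₁ ∷ p₂ ∷ p₃ ∷ []) (x ∷ y ∷ z ∷ []))) where

  ¬contains⇒Avoids : ∀ w → ¬ T (contains (p₁ ∷ p₂ ∷ p₃ ∷ []) w) → Avoids P (w !_) (length w)
  ¬contains⇒Avoids w ¬contains i<j j<k k<n Pijk =
    ¬contains (any⁺ _ (lose (∈-subseqs₃⁺ w i<j j<k k<n) (P⇒same Pijk)))

  Avoids⇒¬contains : ∀ w → Avoids P (w !_) (length w) → ¬ T (contains (p₁ ∷ p₂ ∷ p₃ ∷ []) w)
  Avoids⇒¬contains w avoids contains
    with s , s∈subseqs , same ← find (any⁻ _ _ contains)
    with i , j , k , i<j , j<k , k<n , refl ← ∈-subseqs₃⁻ w s∈subseqs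
    = avoids i<j j<k k<n (same⇒P same)

avoids132-321⇒Avoids : ∀ w → T (avoids132-321 w) → Avoids Order132 (w !_) (length w) × Avoids Order321 (w !_) (length w)
avoids132-321⇒Avoids w avoids with ¬132 , ¬321 ← Equivalence.to T-∧ avoids =
  ¬contains⇒Avoids {1} {3} {2} Order132 sameOrder-132⁻ sameOrder-132⁺ w (T-not⁻ ¬132) ,
  ¬contains⇒Avoids {3} {2} {1} Order321 sameOrder-321⁻ sameOrder-321⁺ w (T-not⁻ ¬321)

Avoids⇒avoids132-321 : ∀ w → Avoids Order132 (w !_) (length w) → Avoids Order321 (w !_) (length w) → T (avoids132-321 w)
Avoids⇒avoids132-321 w no132 no321 = Equivalence.from T-∧
  ( T-not⁺ (Avoids⇒¬contains {1} {3} {2} Order132 sameOrder-132⁻ sameOrder-132⁺ w no132)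
  , T-not⁺ (Avoids⇒¬contains {3} {2} {1} Order321 sameOrder-321⁻ sameOrder-321⁺ w no321))

-- The permutations in Av(132, 321)

-- rotate a b is the permutation a+1 … a+b 1 … a a+b+1 … n with positions and values shifted to
-- start at 0.
opaque
  rotate : ℕ → ℕ → ℕ → ℕ
  rotate a b i = if i <ᵇ b then a + i else if i <ᵇ a + b then i ∸ b else i

  rotate-front : ∀ {a b i} → i < b → rotate a b i ≡ a + i
  rotate-front i<b rewrite <⇒<ᵇ≡true i<b = refl

  rotate-middle : ∀ {a b t} → t < a → rotate a b (b + t) ≡ t
  rotate-middle {a} {b} {t} t<a
    rewrite ≥⇒<ᵇ≡false (m≤m+n b t) | <⇒<ᵇ≡true (subst (b + t <_) (+-comm b a) (+-monoʳ-< b t<a)) = m+n∸m≡n b t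

  rotate-back : ∀ {a b i} → a + b ≤ i → rotate a b i ≡ i
  rotate-back {a} a+b≤i rewrite ≥⇒<ᵇ≡false (m+n≤o⇒n≤o a a+b≤i) | ≥⇒<ᵇ≡false a+b≤i = refl

data Region (a b : ℕ) : ℕ → Set where
  front  : ∀ {i} → i < b → Region a b i
  middle : ∀ {t} → t < a → Region a b (b + t)
  back   : ∀ {i} → a + b ≤ i → Region a b i

region : ∀ a b i → Region a b i
region a b i with i <? b
... | yes i<b = front i<b
... | no i≮b with i ∸ b <? a
...   | yes t<a = subst (Region a b) (m+[n∸m]≡n (≮⇒≥ i≮b)) (middle t<a)
...   | no t≮a  = back (subst (a + b ≤_) (m∸n+n≡m (≮⇒≥ i≮b)) (+-monoˡ-≤ b (≮⇒≥ t≮a)))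

rotate-inverse : ∀ a b i → rotate a b (rotate b a i) ≡ i
rotate-inverse a b i with region b a i
... | front i<a  = trans (cong (rotate a b) (rotate-front i<a)) (rotate-middle i<a)
... | middle t<b = trans (cong (rotate a b) (rotate-middle t<b)) (rotate-front t<b)
... | back b+a≤i = trans (cong (rotate a b) (rotate-back b+a≤i)) (rotate-back (subst (_≤ i) (+-comm b a) b+a≤i))

rotate-injective : ∀ a b {i j} → rotate a b i ≡ rotate a b j → i ≡ j
rotate-injective a b {i} {j} eq = trans (sym (rotate-inverse b a i)) (trans (cong (rotate b a) eq) (rotate-inverse b a j))

module _ {a b : ℕ} where

  rotate-<-prefix : ∀ {i} → i < a + b → rotate a b i < a + b
  rotate-<-prefix {i} i<a+b with region a b i
  ... | front i<b      = subst (_< a + b) (sym (rotate-front i<b)) (+-monoʳ-< a i<b)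
  ... | middle {t} t<a = subst (_< a + b) (sym (rotate-middle t<a)) (<-≤-trans t<a (m≤m+n a b))
  ... | back a+b≤i     = ⊥-elim (<⇒≱ i<a+b a+b≤i)

  rotate-< : ∀ {n i} → a + b ≤ n → i < n → rotate a b i < n
  rotate-< {n} {i} a+b≤n i<n with i <? a + b
  ... | yes i<a+b = <-≤-trans (rotate-<-prefix i<a+b) a+b≤n
  ... | no i≮a+b  = subst (_< n) (sym (rotate-back (≮⇒≥ i≮a+b))) i<n

  rotate-≤ : ∀ {i} → b ≤ i → rotate a b i ≤ i
  rotate-≤ {i} b≤i with region a b i
  ... | front i<b      = ⊥-elim (<⇒≱ i<b b≤i)
  ... | middle {t} t<a = subst (_≤ b + t) (sym (rotate-middle t<a)) (m≤n+m t b)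
  ... | back a+b≤i     = ≤-reflexive (rotate-back a+b≤i)

  rotate-descent : ∀ {j k} → j < k → rotate a b k < rotate a b j → j < b × b ≤ k × rotate a b k < a
  rotate-descent {j} {k} j<k desc with region a b j | region a b k
  ... | front j<b | front k<b  = ⊥-elim (<-asym j<k (+-cancelˡ-< a _ _ (subst₂ _<_ (rotate-front k<b) (rotate-front j<b) desc)))
  ... | front j<b | middle t<a = j<b , m≤m+n b _ , subst (_< a) (sym (rotate-middle t<a)) t<a
  ... | front j<b | back a+b≤k =
    ⊥-elim (<⇒≱ (subst₂ _<_ (rotate-back a+b≤k) (rotate-front j<b) desc) (≤-trans (<⇒≤ (+-monoʳ-< a j<b)) a+b≤k))
  ... | middle {t} _ | front k<b = ⊥-elim (<⇒≱ (<-trans j<k k<b) (m≤m+n b t))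
  ... | middle {t} t<a | middle {t'} t'<a =
    ⊥-elim (<-asym (+-cancelˡ-< b t t' j<k) (subst₂ _<_ (rotate-middle t'<a) (rotate-middle t<a) desc))
  ... | middle t<a | back a+b≤k =
    ⊥-elim (<⇒≱ (<-trans (subst₂ _<_ (rotate-back a+b≤k) (rotate-middle t<a) desc) t<a) (≤-trans (m≤m+n a b) a+b≤k))
  ... | back a+b≤j | front k<b = ⊥-elim (<⇒≱ (<-trans j<k k<b) (≤-trans (m≤n+m b a) a+b≤j))
  ... | back a+b≤j | middle {t'} t'<a =
    ⊥-elim (<⇒≱ j<k (≤-trans (<⇒≤ (subst (b + t' <_) (+-comm b a) (+-monoʳ-< b t'<a))) a+b≤j))
  ... | back a+b≤j | back a+b≤k =
    ⊥-elim (<-asym j<k (subst₂ _<_ (rotate-back a+b≤k) (rotate-back a+b≤j) desc))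

identity : ℕ → List ℕ
identity n = applyUpTo suc n

rotation : ℕ → ℕ → ℕ → List ℕ
rotation n a b = applyUpTo (suc ∘ rotate a b) n

IsPermutation-suc : ∀ {n} → IsPermutation n suc
IsPermutation-suc = record
  { bounded    = λ i<n → z<s , i<n
  ; injective  = λ _ _ → suc-injective
  ; surjective = λ { {suc u} _ u<n → u , u<n , refl }
  }

IsPermutation-rotate : ∀ {n a b} → a + b ≤ n → IsPermutation n (suc ∘ rotate a b)
IsPermutation-rotate {n} {a} {b} a+b≤n = record
  { bounded    = λ i<n → z<s , rotate-< a+b≤n i<n
  ; injective  = λ _ _ → rotate-injective a b ∘ suc-injective
  ; surjective = λ { {suc u} _ u<n → rotate b a u , rotate-< (subst (_≤ n) (+-comm a b) a+b≤n) u<n , cong suc (rotate-inverse a b u) }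
  }

Avoids-suc-132 : ∀ {n} → Avoids Order132 suc n
Avoids-suc-132 _ j<k _ (_ , k<j) = <-asym j<k (s<s⁻¹ k<j)

Avoids-suc-321 : ∀ {n} → Avoids Order321 suc n
Avoids-suc-321 i<j _ _ (_ , j<i) = <-asym i<j (s<s⁻¹ j<i)

Avoids-rotate-132 : ∀ {n a b} → Avoids Order132 (suc ∘ rotate a b) n
Avoids-rotate-132 {a = a} {b} {i} i<j j<k _ (ri<rk , rk<rj)
  with j<b , _ , rk<a ← rotate-descent j<k (s<s⁻¹ rk<rj)
  = <⇒≱ (<-trans (s<s⁻¹ ri<rk) rk<a) (subst (a ≤_) (sym (rotate-front (<-trans i<j j<b))) (m≤m+n a i))

Avoids-rotate-321 : ∀ {n a b} → Avoids Order321 (suc ∘ rotate a b) n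
Avoids-rotate-321 i<j j<k _ (rk<rj , rj<ri) =
  <⇒≱ (proj₁ (rotate-descent j<k (s<s⁻¹ rk<rj))) (proj₁ (proj₂ (rotate-descent i<j (s<s⁻¹ rj<ri))))

strictlyIncreasing⇒≡suc : ∀ {m} (ψ : ℕ → ℕ) → (∀ {t} → suc t < m → ψ t < ψ (suc t)) →
                          (∀ {t} → t < m → 0 < ψ t × ψ t ≤ m) → ∀ {t} → t < m → ψ t ≡ suc t
strictlyIncreasing⇒≡suc {m} ψ increasing bounded {t} t<m = ≤-antisym upper (lower t<m)
  where
  lower : ∀ {t} → t < m → suc t ≤ ψ t
  lower {zero}  0<m  = proj₁ (bounded 0<m)
  lower {suc t} st<m = ≤-trans (s≤s (lower (<-trans (n<1+n t) st<m))) (increasing st<m)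

  gap : ∀ d {t} → t + d < m → ψ t + d ≤ ψ (t + d)
  gap zero    {t} _      rewrite +-identityʳ (ψ t) | +-identityʳ t = ≤-refl
  gap (suc d) {t} t+sd<m rewrite +-suc (ψ t) d | +-suc t d =
    ≤-trans (s≤s (gap d (<-trans (n<1+n (t + d)) t+sd<m))) (increasing t+sd<m)

  d = m ∸ suc t

  upper : ψ t ≤ suc t
  upper = +-cancelʳ-≤ d (ψ t) (suc t) (begin
    ψ t + d      ≤⟨ gap d (subst (t + d <_) (m+[n∸m]≡n t<m) (n<1+n (t + d))) ⟩
    ψ (t + d)    ≤⟨ proj₂ (bounded (subst (t + d <_) (m+[n∸m]≡n t<m) (n<1+n (t + d)))) ⟩
    m            ≡⟨ m+[n∸m]≡n t<m ⟨
    suc t + d    ∎)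
    where open ≤-Reasoning

Outside : ℕ → ℕ → ℕ → Set
Outside a b v = v ≤ a ⊎ a + b < v

-- Closes the gap left by deleting the values a+1 … a+b.
opaque
  squeeze : ℕ → ℕ → ℕ → ℕ
  squeeze a b v = if v ≤ᵇ a then v else v ∸ b

  squeeze-≤ : ∀ {a b v} → v ≤ a → squeeze a b v ≡ v
  squeeze-≤ v≤a rewrite ≤⇒≤ᵇ≡true v≤a = refl

  squeeze-> : ∀ {a b v} → a < v → squeeze a b v ≡ v ∸ b
  squeeze-> a<v rewrite >⇒≤ᵇ≡false a<v = refl

module _ {a b : ℕ} where

  private
    a<v : ∀ {v} → a + b < v → a < v
    a<v a+b<v = ≤-<-trans (m≤m+n a b) a+b<v

    b≤v : ∀ {v} → a + b < v → b ≤ v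
    b≤v a+b<v = ≤-trans (m≤n+m b a) (<⇒≤ a+b<v)

  squeeze-< : ∀ {v w} → Outside a b v → Outside a b w → v < w → squeeze a b v < squeeze a b w
  squeeze-< (inj₁ v≤a) (inj₁ w≤a) v<w rewrite squeeze-≤ {b = b} v≤a | squeeze-≤ {b = b} w≤a = v<w
  squeeze-< (inj₁ v≤a) (inj₂ a+b<w) _
    rewrite squeeze-≤ {b = b} v≤a | squeeze-> {b = b} (a<v a+b<w) = ≤-<-trans v≤a (m+n≤o⇒m≤o∸n (suc a) a+b<w)
  squeeze-< (inj₂ a+b<v) (inj₁ w≤a) v<w = ⊥-elim (<⇒≱ (<-trans a+b<v v<w) (≤-trans w≤a (m≤m+n a b)))
  squeeze-< (inj₂ a+b<v) (inj₂ a+b<w) v<w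
    rewrite squeeze-> {b = b} (a<v a+b<v) | squeeze-> {b = b} (a<v a+b<w) = ∸-monoˡ-< v<w (b≤v a+b<v)

  squeeze-bounds : ∀ {n v} → a + b ≤ n → 0 < v → v ≤ n → Outside a b v → 0 < squeeze a b v × squeeze a b v ≤ n ∸ b
  squeeze-bounds a+b≤n 0<v v≤n (inj₁ v≤a) rewrite squeeze-≤ {b = b} v≤a = 0<v , ≤-trans v≤a (m+n≤o⇒m≤o∸n a a+b≤n)
  squeeze-bounds a+b≤n 0<v v≤n (inj₂ a+b<v) rewrite squeeze-> {b = b} (a<v a+b<v) =
    m<n⇒0<n∸m (≤-<-trans (m≤n+m b a) a+b<v) , ∸-monoˡ-≤ b v≤n

  squeeze-decode : ∀ {v t} → Outside a b v → squeeze a b v ≡ suc t → v ≡ suc (rotate a b (b + t))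
  squeeze-decode {v} {t} (inj₁ v≤a) v≡ rewrite squeeze-≤ {b = b} v≤a =
    trans v≡ (cong suc (sym (rotate-middle (subst (_≤ a) v≡ v≤a))))
  squeeze-decode {v} {t} (inj₂ a+b<v) v∸b≡ rewrite squeeze-> {b = b} (a<v a+b<v) =
    trans v≡ (cong suc (sym (rotate-back (s≤s⁻¹ (subst (a + b <_) v≡ a+b<v)))))
    where
    v≡ : v ≡ suc (b + t)
    v≡ = trans (sym (m∸n+n≡m (b≤v a+b<v))) (trans (cong (_+ b) v∸b≡) (cong suc (+-comm t b)))

data Classification (n : ℕ) (π : ℕ → ℕ) : Set where
  ascending : (∀ {i} → i < n → π i ≡ suc i) → Classification n π
  rotated : ∀ a b → 0 < a → 0 < b → a + b ≤ n → (∀ {i} → i < n → π i ≡ suc (rotate a b i)) → Classification n π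

module Classify {n π} (perm : IsPermutation n π) (no132 : Avoids Order132 π n) (no321 : Avoids Order321 π n) where
  open IsPermutation perm

  <-by-values : ∀ {i j} → i < n → j < n → i ≢ j → ¬ π j < π i → π i < π j
  <-by-values i<n j<n i≢j πj≮πi = ≤∧≢⇒< (≮⇒≥ πj≮πi) (i≢j ∘ injective i<n j<n)

  module Ascending {p} (p<n : p < n) (πp≡1 : π p ≡ 1) where

    πp<π : ∀ {j} → j < n → j ≢ p → π p < π j
    πp<π {j} j<n j≢p = <-by-values p<n j<n (j≢p ∘ sym)
      (λ πj<πp → <⇒≱ πj<πp (subst (_≤ π j) (sym πp≡1) (proj₁ (bounded j<n))))

    ascending-before : ∀ {i j} → i < j → j < p → π i < π j
    ascending-before {i} {j} i<j j<p = <-by-values (<-trans i<j j<n) j<n (<⇒≢ i<j)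
      (λ πj<πi → no321 i<j j<p p<n (πp<π j<n (<⇒≢ j<p) , πj<πi))
      where j<n : j < n
            j<n = <-trans j<p p<n

    ascending-before⁻¹ : ∀ {i j} → i < p → j < p → π i < π j → i < j
    ascending-before⁻¹ {i} {j} i<p j<p πi<πj with <-cmp i j
    ... | tri< i<j _ _ = i<j
    ... | tri≈ _ refl _ = ⊥-elim (<-irrefl refl πi<πj)
    ... | tri> _ _ j<i = ⊥-elim (<-asym πi<πj (ascending-before j<i i<p))

    ascending-from : ∀ {j k} → p ≤ j → j < k → k < n → π j < π k
    ascending-from {j} {k} p≤j j<k k<n = <-by-values (<-trans j<k k<n) k<n (<⇒≢ j<k) not-descent
      where
      not-descent : ¬ π k < π j
      not-descent πk<πj with m≤n⇒m<n∨m≡n p≤j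
      ... | inj₁ p<j  = no132 p<j j<k k<n (πp<π k<n (λ { refl → <-asym p<j j<k }) , πk<πj)
      ... | inj₂ refl = <⇒≱ πk<πj (<⇒≤ (πp<π k<n (λ { refl → <-irrefl refl j<k })))

  module Rotated {b'} (b<n : suc b' < n) (πb≡1 : π (suc b') ≡ 1) where
    open Ascending b<n πb≡1

    b a : ℕ
    b = suc b'
    a = pred (π 0)

    1<π0 : 1 < π 0
    1<π0 = subst (_< π 0) πb≡1 (πp<π (<-trans z<s b<n) (λ ()))

    π0≡suc-a : π 0 ≡ suc a
    π0≡suc-a = sym (suc-pred (π 0) {{>-nonZero (<-trans z<s 1<π0)}})

    0<a : 0 < a
    0<a = s<s⁻¹ (subst (1 <_) π0≡suc-a 1<π0)

    -- The value π i + 1 is neither before b (the prefix increases), nor at b (π b = 1), nor after b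
    -- (it would complete a 132).
    prefix-step : ∀ {i} → suc i < b → π (suc i) ≡ suc (π i)
    prefix-step {i} si<b = ≤-antisym (≮⇒≥ no-gap) (ascending-before (n<1+n i) si<b)
      where
      si<n : suc i < n
      si<n = <-trans si<b b<n
      i<n : i < n
      i<n = <-trans (n<1+n i) si<n
      no-gap : ¬ suc (π i) < π (suc i)
      no-gap gap with q , q<n , πq≡ ← surjective z<s (≤-trans (<⇒≤ gap) (proj₂ (bounded si<n)))
        with πi<πq ← subst (π i <_) (sym πq≡) (n<1+n (π i))
        with πq<πsi ← subst (_< π (suc i)) (sym πq≡) gap
        with <-cmp q b
      ... | tri< q<b _ _ =
        <⇒≱ (ascending-before⁻¹ (<-trans (n<1+n i) si<b) q<b πi<πq) (s≤s⁻¹ (ascending-before⁻¹ q<b si<b πq<πsi))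
      ... | tri≈ _ refl _ = <⇒≢ (proj₁ (bounded i<n)) (sym (suc-injective (trans (sym πq≡) πb≡1)))
      ... | tri> _ _ b<q = no132 (n<1+n i) (<-trans si<b b<q) q<n (πi<πq , πq<πsi)

    prefix : ∀ {i} → i < b → π i ≡ suc (a + i)
    prefix {zero}  _    = trans π0≡suc-a (cong suc (sym (+-identityʳ a)))
    prefix {suc i} si<b =
      trans (prefix-step si<b) (cong suc (trans (prefix (<-trans (n<1+n i) si<b)) (sym (+-suc a i))))

    a+b≤n : a + b ≤ n
    a+b≤n = subst (_≤ n) (trans (prefix (n<1+n b')) (sym (+-suc a b'))) (proj₂ (bounded (<-trans (n<1+n b') b<n)))

    outside : ∀ {i} → b ≤ i → i < n → Outside a b (π i)
    outside {i} b≤i i<n with π i ≤? a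
    ... | yes πi≤a = inj₁ πi≤a
    ... | no πi≰a with a + b <? π i
    ...   | yes a+b<πi = inj₂ a+b<πi
    ...   | no a+b≮πi  = ⊥-elim (<⇒≱ t<b (subst (b ≤_) (sym t≡i) b≤i))
      where
      t : ℕ
      t = π i ∸ suc a
      t<b : t < b
      t<b = +-cancelˡ-< a t b (subst (_≤ a + b) (sym (m+[n∸m]≡n (≰⇒> πi≰a))) (≮⇒≥ a+b≮πi))
      πt≡πi : π t ≡ π i
      πt≡πi = trans (prefix t<b) (m+[n∸m]≡n (≰⇒> πi≰a))
      t≡i : t ≡ i
      t≡i = injective (<-trans t<b b<n) i<n πt≡πi

    b+t<n⇒t<n∸b : ∀ {t} → b + t < n → t < n ∸ b
    b+t<n⇒t<n∸b {t} b+t<n = m+n≤o⇒m≤o∸n (suc t) (subst (_≤ n) (cong suc (+-comm b t)) b+t<n)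

    t<n∸b⇒b+t<n : ∀ {t} → t < n ∸ b → b + t < n
    t<n∸b⇒b+t<n {t} t<n∸b = subst (_≤ n) (cong suc (+-comm t b)) (m≤o∸n⇒m+n≤o (suc t) (<⇒≤ b<n) t<n∸b)

    ψ : ℕ → ℕ
    ψ t = squeeze a b (π (b + t))

    suffix : ∀ {t} → b + t < n → π (b + t) ≡ suc (rotate a b (b + t))
    suffix {t} b+t<n = squeeze-decode (outside-at b+t<n) (strictlyIncreasing⇒≡suc ψ ψ-increasing ψ-bounds (b+t<n⇒t<n∸b b+t<n))
      where
      outside-at : ∀ {t} → b + t < n → Outside a b (π (b + t))
      outside-at {t} = outside (m≤m+n b t)
      ψ-increasing : ∀ {t} → suc t < n ∸ b → ψ t < ψ (suc t)
      ψ-increasing {t} st<n∸b = squeeze-< (outside-at (<-trans (+-monoʳ-< b (n<1+n t)) b+st<n)) (outside-at b+st<n)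
                                          (ascending-from (m≤m+n b t) (+-monoʳ-< b (n<1+n t)) b+st<n)
        where b+st<n = t<n∸b⇒b+t<n st<n∸b
      ψ-bounds : ∀ {t} → t < n ∸ b → 0 < ψ t × ψ t ≤ n ∸ b
      ψ-bounds t<n∸b with b+t<n ← t<n∸b⇒b+t<n t<n∸b =
        squeeze-bounds a+b≤n (proj₁ (bounded b+t<n)) (proj₂ (bounded b+t<n)) (outside-at b+t<n)

    rotation-form : ∀ {i} → i < n → π i ≡ suc (rotate a b i)
    rotation-form {i} i<n with i <? b
    ... | yes i<b = trans (prefix i<b) (cong suc (sym (rotate-front i<b)))
    ... | no i≮b  = subst (λ j → π j ≡ suc (rotate a b j)) b+t≡i (suffix (subst (_< n) (sym b+t≡i) i<n))
      where b+t≡i = m+[n∸m]≡n (≮⇒≥ i≮b)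

  classify : Classification n π
  classify with 0 <? n
  ... | no n≯0  = ascending (λ i<n → ⊥-elim (n≯0 (≤-<-trans z≤n i<n)))
  ... | yes 0<n with surjective {1} z<s 0<n
  ...   | zero   , p<n , πp≡1 =
    ascending (strictlyIncreasing⇒≡suc π (Ascending.ascending-from p<n πp≡1 z≤n (n<1+n _)) bounded)
  ...   | suc b' , b<n , πb≡1 = rotated a b 0<a z<s a+b≤n rotation-form
    where open Rotated b<n πb≡1

-- Hook configurations

isDescent : List ℕ → ℕ → Bool
isDescent π i = at π (suc i) <ᵇ at π i

descents-applyUpTo : ∀ f n → descents (applyUpTo f n) ≡ filterᵇ (isDescent (applyUpTo f n)) (range (pred n))
descents-applyUpTo f n = cong (λ m → filterᵇ (isDescent (applyUpTo f n)) (range (pred m))) (length-applyUpTo f n)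

isDescent-applyUpTo : ∀ f n {i} → i ∈ range (pred n) → T (isDescent (applyUpTo f n) i) ⇔ f i < f (pred i)
isDescent-applyUpTo f n       {zero}  0∈range with () ← proj₁ (∈-range⁻ {pred n} 0∈range)
isDescent-applyUpTo f (suc n) {suc i} i∈range =
  subst₂ (λ x y → T (x <ᵇ y) ⇔ f (suc i) < f i)
         (sym (!-applyUpTo f (suc n) si<sn)) (sym (!-applyUpTo f (suc n) (<-trans (n<1+n i) si<sn)))
         (mk⇔ (<ᵇ⇒< _ _) <⇒<ᵇ)
  where
  si<sn : suc i < suc n
  si<sn = s≤s (proj₂ (∈-range⁻ i∈range))

descents-identity : ∀ n → descents (identity n) ≡ []
descents-identity n = trans (descents-applyUpTo suc n) (filter-none _ (All.tabulate no-descent))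
  where
  no-descent : ∀ {i} → i ∈ range (pred n) → ¬ T (isDescent (identity n) i)
  no-descent {suc i} i∈range desc = <-asym (n<1+n i) (s<s⁻¹ (Equivalence.to (isDescent-applyUpTo suc n i∈range) desc))
  no-descent {zero}  0∈range with () ← proj₁ (∈-range⁻ {pred n} 0∈range)

descents-rotation : ∀ {n a b} → 0 < a → 0 < b → a + b ≤ n → descents (rotation n a b) ≡ [ b ]
descents-rotation {n} {a} {suc b'} 0<a 0<b a+b≤n =
  trans (descents-applyUpTo (suc ∘ rotate a b) n) (filterᵇ-range-≡[ _ ] (pred n) b∈range descent-at-b)
  where
  b = suc b'
  b∈range : b ∈ range (pred n)
  b∈range = ∈-range⁺ 0<b (<⇒≤pred (<-≤-trans (m<n+m b 0<a) a+b≤n))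
  descent-at-b : ∀ {i} → i ∈ range (pred n) → T (isDescent (rotation n a b) i) ⇔ i ≡ b
  descent-at-b {zero}   0∈range with () ← proj₁ (∈-range⁻ {pred n} 0∈range)
  descent-at-b {suc i} i∈range = mk⇔ at-b (λ { refl → Equivalence.from descent⇔ (s<s rotate-b<rotate-b') })
    where
    descent⇔ = isDescent-applyUpTo (suc ∘ rotate a b) n i∈range
    at-b : T (isDescent (rotation n a b) (suc i)) → suc i ≡ b
    at-b desc with i<b , b≤si , _ ← rotate-descent (n<1+n i) (s<s⁻¹ (Equivalence.to descent⇔ desc)) = ≤-antisym i<b b≤si
    rotate-b<rotate-b' : rotate a b b < rotate a b b'
    rotate-b<rotate-b' = subst₂ _<_ (sym (trans (cong (rotate a b) (sym (+-identityʳ b))) (rotate-middle 0<a)))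
                                    (sym (rotate-front (n<1+n b'))) (≤-trans 0<a (m≤m+n a b'))

module _ {n a b : ℕ} (0<a : 0 < a) (0<b : 0 < b) (a+b≤n : a + b ≤ n) where

  identity≢rotation : identity n ≢ rotation n a b
  identity≢rotation eq with () ← trans (sym (descents-identity n)) (trans (cong descents eq) (descents-rotation 0<a 0<b a+b≤n))

  rotation-injective : ∀ {a' b'} → 0 < a' → 0 < b' → a' + b' ≤ n → rotation n a b ≡ rotation n a' b' → (a , b) ≡ (a' , b')
  rotation-injective {a'} {b'} 0<a' 0<b' a'+b'≤n eq = cong₂ _,_ a≡a' b≡b'
    where
    b≡b' = ∷-injectiveˡ (trans (sym (descents-rotation 0<a 0<b a+b≤n)) (trans (cong descents eq) (descents-rotation 0<a' 0<b' a'+b'≤n)))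
    0<n = <-≤-trans (≤-trans 0<a (m≤m+n a b)) a+b≤n
    a≡a' = begin
      a                        ≡⟨ +-identityʳ a ⟨
      a + 0                    ≡⟨ rotate-front 0<b ⟨
      rotate a b 0             ≡⟨ suc-injective (trans (sym (!-applyUpTo _ n 0<n)) (trans (cong (_! 0) eq) (!-applyUpTo _ n 0<n))) ⟩
      rotate a' b' 0           ≡⟨ rotate-front 0<b' ⟩
      a' + 0                   ≡⟨ +-identityʳ a' ⟩
      a'                       ∎
      where open ≡-Reasoning

-- isVHC with the descent list as a parameter, so that a computed list can replace descents π.
isVHCWith : List ℕ → List ℕ → List ℕ → Bool
isVHCWith π ds js = all (isHook π) hs ∧ all (nothingAbove π) hs ∧ allPairs (compatible π) hs
  where hs = zipWith _,_ ds js

numVHC-descents : ∀ π {ds} → descents π ≡ ds → numVHC π ≡ count (isVHCWith π ds) (words (range (length π)) (length ds))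
numVHC-descents π refl = refl

numVHC-oneDescent : ∀ π {d} → descents π ≡ [ d ] →
                    numVHC π ≡ ∑[ j ∈ range (length π) ] 𝟙 (isHook π (d , j) ∧ nothingAbove π (d , j))
numVHC-oneDescent π {d} one = begin
  numVHC π                                                       ≡⟨ numVHC-descents π one ⟩
  count (isVHCWith π [ d ]) (words (range (length π)) 1)         ≡⟨ count≡∑ _ (words (range (length π)) 1) ⟩
  ∑[ js ∈ words (range (length π)) 1 ] 𝟙 (isVHCWith π [ d ] js) ≡⟨ ∑-concatMap _ (range (length π)) _ ⟩
  ∑[ j ∈ range (length π) ] (𝟙 (isVHCWith π [ d ] [ j ]) + 0)   ≡⟨ ∑-cong (range (length π)) (λ _ → single-hook) ⟩
  ∑[ j ∈ range (length π) ] 𝟙 (isHook π (d , j) ∧ nothingAbove π (d , j)) ∎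
  where
  open ≡-Reasoning
  single-hook : ∀ {j} → 𝟙 (isVHCWith π [ d ] [ j ]) + 0 ≡ 𝟙 (isHook π (d , j) ∧ nothingAbove π (d , j))
  single-hook {j} = trans (+-identityʳ _) (cong 𝟙 (cong₂ _∧_ (∧-identityʳ (isHook π (d , j)))
    (trans (∧-identityʳ (nothingAbove π (d , j) ∧ true)) (∧-identityʳ (nothingAbove π (d , j))))))

numVHC-identity : ∀ n → numVHC (identity n) ≡ 1
numVHC-identity n = numVHC-descents (identity n) (descents-identity n)

module RotationHooks {n a b' : ℕ} (0<a : 0 < a) (a+b≤n : a + suc b' ≤ n) where
  b = suc b'
  π = rotation n a b

  length-π : length π ≡ n
  length-π = length-applyUpTo _ n

  b<n : b < n
  b<n = <-≤-trans (m<n+m b 0<a) a+b≤n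

  at-b : at π b ≡ a + b
  at-b = trans (!-applyUpTo _ n (<-trans (n<1+n b') b<n)) (trans (cong suc (rotate-front (n<1+n b'))) (sym (+-suc a b')))

  hook⇒a+b<j : ∀ {j} → j ∈ range n → T (isHook π (b , j)) → a + b < j
  hook⇒a+b<j {suc j'} j∈range hook with j' <? a + b
  ... | no j'≮a+b = s≤s (≮⇒≥ j'≮a+b)
  ... | yes j'<a+b = ⊥-elim (<⇒≱ (rotate-<-prefix j'<a+b) (s≤s⁻¹ (subst₂ _<_ at-b (!-applyUpTo _ n j'<n) πb<πj)))
    where
    j'<n = proj₂ (∈-range⁻ j∈range)
    πb<πj : at π b < at π (suc j')
    πb<πj = <ᵇ⇒< _ _ (proj₂ (Equivalence.to T-∧ (proj₂ (Equivalence.to (T-∧ {b <ᵇ suc j'}) hook))))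
  hook⇒a+b<j {zero} 0∈range with () ← proj₁ (∈-range⁻ {n} 0∈range)

  a+b<j⇒hook : ∀ {j} → j ∈ range n → a + b < j → T (isHook π (b , j) ∧ nothingAbove π (b , j))
  a+b<j⇒hook {suc j'} j∈range (s≤s a+b≤j') = Equivalence.from T-∧
    ( Equivalence.from T-∧ (<⇒<ᵇ (s≤s (≤-trans (m≤n+m b a) a+b≤j')) ,
      Equivalence.from T-∧ (≤⇒≤ᵇ (subst (suc j' ≤_) (sym length-π) j'<n) ,
                            subst₂ (λ x y → T (x <ᵇ y)) (sym at-b) (sym at-j) (<⇒<ᵇ (s≤s a+b≤j'))))
    , all⁻ _ (All.tabulate nothing-above))
    where
    j'<n = proj₂ (∈-range⁻ j∈range)
    at-j : at π (suc j') ≡ suc j'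
    at-j = trans (!-applyUpTo _ n j'<n) (cong suc (rotate-back a+b≤j'))
    nothing-above : ∀ {k} → k ∈ range (length π) → T (not ((b <ᵇ k) ∧ (k <ᵇ suc j') ∧ (at π (suc j') <ᵇ at π k)))
    nothing-above {zero}  0∈range with () ← proj₁ (∈-range⁻ {length π} 0∈range)
    nothing-above {suc k'} k∈range = T-not-∧₃ λ b<k k<j πj<πk →
      <⇒≱ (<ᵇ⇒< _ _ πj<πk)
          (begin
            at π (suc k')          ≡⟨ !-applyUpTo _ n k'<n ⟩
            suc (rotate a b k')    ≤⟨ s≤s (rotate-≤ (s≤s⁻¹ (<ᵇ⇒< b _ b<k))) ⟩
            suc k'                 ≤⟨ <ᵇ⇒< _ _ k<j ⟩
            j'                     <⟨ n<1+n j' ⟩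
            suc j'                 ≡⟨ at-j ⟨
            at π (suc j')          ∎)
      where
      open ≤-Reasoning
      k'<n = subst (k' <_) length-π (proj₂ (∈-range⁻ k∈range))

numVHC-rotation : ∀ {n a b} → 0 < a → 0 < b → a + b ≤ n → numVHC (rotation n a b) ≡ n ∸ (a + b)
numVHC-rotation {n} {a} {suc b'} 0<a 0<b a+b≤n = begin
  numVHC π
    ≡⟨ numVHC-oneDescent π (descents-rotation 0<a 0<b a+b≤n) ⟩
  ∑[ j ∈ range (length π) ] valid j
    ≡⟨ cong (λ m → ∑[ j ∈ range m ] valid j) length-π ⟩
  ∑[ j ∈ range n ] valid j
    ≡⟨ ∑-cong (range n) (λ j∈range → 𝟙-cong (<⇒<ᵇ ∘ hook⇒a+b<j j∈range ∘ proj₁ ∘ Equivalence.to T-∧)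
                                            (a+b<j⇒hook j∈range ∘ <ᵇ⇒< _ _)) ⟩
  ∑[ j ∈ range n ] 𝟙 (a + b <ᵇ j)
    ≡⟨ ∑-range-<ᵇ n (a + b) ⟩
  n ∸ (a + b) ∎
  where
  open RotationHooks 0<a a+b≤n
  open ≡-Reasoning
  valid : ℕ → ℕ
  valid j = 𝟙 (isHook π (b , j) ∧ nothingAbove π (b , j))

-- Binomial sums

pascal : ∀ n k → suc n C suc k ≡ n C k + n C suc k
pascal n k = sym (nCk+nC[k+1]≡[n+1]C[k+1] n k)

pascal-pred : ∀ m k → pred m C suc k + pred m C suc (suc k) ≡ m C suc (suc k)
pascal-pred zero    k = refl
pascal-pred (suc m) k = nCk+nC[k+1]≡[n+1]C[k+1] m (suc k)

hockey-stick-partial : ∀ N m k → ∑[ i ∈ range N ] ((m ∸ i) C suc k) + (m ∸ N) C suc (suc k) ≡ m C suc (suc k)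
hockey-stick-partial zero    m k = refl
hockey-stick-partial (suc N) m k = begin
  ∑[ i ∈ range (suc N) ] term i + (m ∸ suc N) C suc (suc k)
    ≡⟨ cong (_+ (m ∸ suc N) C suc (suc k)) (∑-range-suc N term) ⟩
  ∑[ i ∈ range N ] term i + (m ∸ suc N) C suc k + (m ∸ suc N) C suc (suc k)
    ≡⟨ +-assoc (∑ (range N) term) _ _ ⟩
  ∑[ i ∈ range N ] term i + ((m ∸ suc N) C suc k + (m ∸ suc N) C suc (suc k))
    ≡⟨ cong (λ d → ∑ (range N) term + (d C suc k + d C suc (suc k))) (pred[m∸n]≡m∸[1+n] m N) ⟨
  ∑[ i ∈ range N ] term i + (pred (m ∸ N) C suc k + pred (m ∸ N) C suc (suc k))
    ≡⟨ cong (_+_ (∑ (range N) term)) (pascal-pred (m ∸ N) k) ⟩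
  ∑[ i ∈ range N ] term i + (m ∸ N) C suc (suc k)
    ≡⟨ hockey-stick-partial N m k ⟩
  m C suc (suc k) ∎
  where
  open ≡-Reasoning
  term : ℕ → ℕ
  term i = (m ∸ i) C suc k

hockey-stick : ∀ m k → ∑[ i ∈ range m ] ((m ∸ i) C suc k) ≡ m C suc (suc k)
hockey-stick m k = begin
  ∑[ i ∈ range m ] term i                                ≡⟨ +-identityʳ _ ⟨
  ∑[ i ∈ range m ] term i + 0 C suc (suc k)              ≡⟨ cong (λ d → ∑ (range m) term + d C suc (suc k)) (n∸n≡0 m) ⟨
  ∑[ i ∈ range m ] term i + (m ∸ m) C suc (suc k)        ≡⟨ hockey-stick-partial m m k ⟩
  m C suc (suc k)                                        ∎
  where
  open ≡-Reasoning
  term : ℕ → ℕ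
  term i = (m ∸ i) C suc k

∑∑-range-∸ : ∀ n → ∑[ a ∈ range n ] ∑[ b ∈ range (n ∸ a) ] (n ∸ a ∸ b) ≡ n C 3
∑∑-range-∸ n = begin
  ∑[ a ∈ range n ] ∑[ b ∈ range (n ∸ a) ] (n ∸ a ∸ b)    ≡⟨ ∑-cong (range n) (λ {a} _ → inner a) ⟩
  ∑[ a ∈ range n ] ((n ∸ a) C 2)                          ≡⟨ hockey-stick n 1 ⟩
  n C 3                                                   ∎
  where
  open ≡-Reasoning
  inner : ∀ a → ∑[ b ∈ range (n ∸ a) ] (n ∸ a ∸ b) ≡ (n ∸ a) C 2
  inner a = trans (∑-cong (range (n ∸ a)) (λ {b} _ → sym (nC1≡n (n ∸ a ∸ b)))) (hockey-stick (n ∸ a) 0)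

ℤ-rearrange : ∀ x y z r → x + 3 * z ≡ 3 * y + r → + r ≡ (+ x ℤ.- + 3 ℤ.* + y) ℤ.+ + 3 ℤ.* + z
ℤ-rearrange x y z r eq = sym (begin
  (+ x ℤ.- + 3 ℤ.* + y) ℤ.+ + 3 ℤ.* + z    ≡⟨ regroup (+ x) (+ y) (+ z) ⟩
  (+ x ℤ.+ + 3 ℤ.* + z) ℤ.- + 3 ℤ.* + y    ≡⟨ cong (ℤ._- + 3 ℤ.* + y) eqℤ ⟩
  (+ 3 ℤ.* + y ℤ.+ + r) ℤ.- + 3 ℤ.* + y    ≡⟨ cancel (+ y) (+ r) ⟩
  + r                                      ∎)
  where
  open ≡-Reasoning
  regroup : ∀ X Y Z → (X ℤ.- + 3 ℤ.* Y) ℤ.+ + 3 ℤ.* Z ≡ (X ℤ.+ + 3 ℤ.* Z) ℤ.- + 3 ℤ.* Y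
  regroup = solve-∀-ℤ
  cancel : ∀ Y R → (+ 3 ℤ.* Y ℤ.+ R) ℤ.- + 3 ℤ.* Y ≡ R
  cancel = solve-∀-ℤ
  eqℤ : + x ℤ.+ + 3 ℤ.* + z ≡ + 3 ℤ.* + y ℤ.+ + r
  eqℤ = begin
    + x ℤ.+ + 3 ℤ.* + z   ≡⟨ cong (ℤ._+_ (+ x)) (ℤ.pos-* 3 z) ⟨
    + x ℤ.+ + (3 * z)     ≡⟨ ℤ.pos-+ x (3 * z) ⟨
    + (x + 3 * z)         ≡⟨ cong +_ eq ⟩
    + (3 * y + r)         ≡⟨ ℤ.pos-+ (3 * y) r ⟩
    + (3 * y) ℤ.+ + r     ≡⟨ cong (ℤ._+ + r) (ℤ.pos-* 3 y) ⟩
    + 3 ℤ.* + y ℤ.+ + r   ∎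

binomial-identity : ∀ n → + suc (n C 3) ≡ (+ ((n + 3) C 3) ℤ.- + 3 ℤ.* + ((n + 2) C 3)) ℤ.+ + 3 ℤ.* + ((n + 1) C 3)
binomial-identity n rewrite +-comm n 3 | +-comm n 2 | +-comm n 1 =
  ℤ-rearrange (3+n C 3) (2+n C 3) (1+n C 3) (suc c₃) (begin
    3+n C 3 + 3 * (1+n C 3)                                                    ≡⟨ cong₂ (λ u v → u + 3 * v) C3[3+n] C3[1+n] ⟩
    suc n + (n + c₂) + ((n + c₂) + (c₂ + c₃)) + 3 * (c₂ + c₃)                  ≡⟨ collect n c₂ c₃ ⟩
    3 * ((n + c₂) + (c₂ + c₃)) + suc c₃                                         ≡⟨ cong (λ u → 3 * u + suc c₃) C3[2+n] ⟨
    3 * (2+n C 3) + suc c₃                                                      ∎)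
  where
  open ≡-Reasoning
  collect : ∀ n c₂ c₃ → suc n + (n + c₂) + ((n + c₂) + (c₂ + c₃)) + 3 * (c₂ + c₃) ≡
                        3 * ((n + c₂) + (c₂ + c₃)) + suc c₃
  collect = solve-∀
  c₂ = n C 2
  c₃ = n C 3
  1+n = suc n
  2+n = suc (suc n)
  3+n = suc (suc (suc n))
  C2[1+n] : 1+n C 2 ≡ n + c₂
  C2[1+n] = trans (pascal n 1) (cong (_+ c₂) (nC1≡n n))
  C3[1+n] : 1+n C 3 ≡ c₂ + c₃
  C3[1+n] = pascal n 2
  C3[2+n] : 2+n C 3 ≡ (n + c₂) + (c₂ + c₃)
  C3[2+n] = trans (pascal 1+n 2) (cong₂ _+_ C2[1+n] C3[1+n])
  C3[3+n] : 3+n C 3 ≡ suc n + (n + c₂) + ((n + c₂) + (c₂ + c₃))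
  C3[3+n] = trans (pascal 2+n 2) (cong₂ _+_ (trans (pascal 1+n 1) (cong₂ _+_ (nC1≡n 1+n) C2[1+n])) C3[2+n])

-- Counting

shapes : ℕ → List (ℕ × ℕ)
shapes n = concatMap (λ a → map (a ,_) (range (n ∸ a))) (range n)

∈-shapes⁻ : ∀ {n a b} → (a , b) ∈ shapes n → 0 < a × 0 < b × a + b ≤ n
∈-shapes⁻ {n} ab∈shapes
  with a , a∈range , ab∈map ← find (∈-concatMap⁻ (λ a → map (a ,_) (range (n ∸ a))) {xs = range n} ab∈shapes)
  with b , b∈range , refl ← ∈-map⁻ (a ,_) ab∈map
  with 0<a , a≤n ← ∈-range⁻ {n} a∈range
  with 0<b , b≤n∸a ← ∈-range⁻ {n ∸ a} b∈range
  = 0<a , 0<b , subst (_≤ n) (+-comm b a) (m≤o∸n⇒m+n≤o b a≤n b≤n∸a)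

multiplicity-shapes : ∀ {n a b} → 0 < a → 0 < b → a + b ≤ n → multiplicity (a , b) (shapes n) ≡ 1
multiplicity-shapes {n} {a} {b} 0<a 0<b a+b≤n =
  trans (multiplicity-concatMap-map _,_ ,-injective (range n) (λ a → range (n ∸ a)) a b)
        (cong₂ _*_ (multiplicity-range 0<a (m+n≤o⇒m≤o a a+b≤n))
                   (multiplicity-range 0<b (m+n≤o⇒m≤o∸n b (subst (_≤ n) (+-comm a b) a+b≤n))))

module Counting (n : ℕ) where

  permutations enumeration : List (List ℕ)
  permutations = filterᵇ (isPerm n) (words (range n) n)
  enumeration  = identity n ∷ map (uncurry (rotation n)) (shapes n)

  listed-once : ∀ {f} → IsPermutation n f → Avoids Order132 f n → Avoids Order321 f n →
                T (avoids132-321 (applyUpTo f n)) × multiplicity (applyUpTo f n) permutations ≡ 1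
  listed-once {f} perm no132 no321 =
    Avoids⇒avoids132-321 (applyUpTo f n) (Avoids-applyUpTo {Order132} no132) (Avoids-applyUpTo {Order321} no321) , (begin
      multiplicity (applyUpTo f n) permutations
        ≡⟨ multiplicity-filterᵇ (isPerm n) {applyUpTo f n} (IsPermutation⇒isPerm perm) (words (range n) n) ⟩
      multiplicity (applyUpTo f n) (words (range n) n)
        ≡⟨ cong (λ k → multiplicity (applyUpTo f n) (words (range n) k)) (length-applyUpTo f n) ⟨
      multiplicity (applyUpTo f n) (words (range n) (length (applyUpTo f n)))
        ≡⟨ multiplicity-words (range n) (applyUpTo f n) entry-once ⟩
      1 ∎)
    where
    open ≡-Reasoning
    entry-once : ∀ {x} → x ∈ applyUpTo f n → multiplicity x (range n) ≡ 1
    entry-once x∈ with i , i<n , refl ← ∈-applyUpTo⁻ f x∈ = uncurry multiplicity-range (IsPermutation.bounded perm i<n)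

  enumerated : ∀ {w} → w ∈ enumeration → T (avoids132-321 w) × multiplicity w permutations ≡ 1
  enumerated (here refl) = listed-once IsPermutation-suc Avoids-suc-132 Avoids-suc-321
  enumerated (there w∈rotations)
    with (a , b) , ab∈shapes , refl ← ∈-map⁻ (uncurry (rotation n)) w∈rotations
    with _ , _ , a+b≤n ← ∈-shapes⁻ ab∈shapes
    = listed-once (IsPermutation-rotate a+b≤n) (Avoids-rotate-132 {a = a} {b}) (Avoids-rotate-321 {a = a} {b})

  multiplicity-identity : multiplicity (identity n) enumeration ≡ 1
  multiplicity-identity = cong₂ _+_ (δ-refl (identity n)) (multiplicity-∉ _ not-rotation)
    where
    not-rotation : identity n ∉ map (uncurry (rotation n)) (shapes n)
    not-rotation id∈
      with (a , b) , ab∈shapes , id≡ ← ∈-map⁻ (uncurry (rotation n)) id∈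
      with 0<a , 0<b , a+b≤n ← ∈-shapes⁻ ab∈shapes
      = identity≢rotation 0<a 0<b a+b≤n id≡

  multiplicity-rotation : ∀ {a b} → 0 < a → 0 < b → a + b ≤ n → multiplicity (rotation n a b) enumeration ≡ 1
  multiplicity-rotation {a} {b} 0<a 0<b a+b≤n =
    cong₂ _+_ (δ-≢ (identity≢rotation 0<a 0<b a+b≤n ∘ sym))
              (trans (multiplicity-map (uncurry (rotation n)) (shapes n) injective) (multiplicity-shapes 0<a 0<b a+b≤n))
    where
    injective : ∀ {s} → s ∈ shapes n → rotation n a b ≡ uncurry (rotation n) s → (a , b) ≡ s
    injective {a' , b'} s∈shapes with 0<a' , 0<b' , a'+b'≤n ← ∈-shapes⁻ s∈shapes =
      rotation-injective 0<a 0<b a+b≤n 0<a' 0<b' a'+b'≤n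

  complete : ∀ {w} → w ∈ permutations → T (avoids132-321 w) → multiplicity w enumeration ≡ 1
  complete {w} w∈permutations avoids
    with w∈words , perm ← ∈-filter⁻ (T? ∘ isPerm n) w∈permutations
    with length-w , _ ← ∈-words⁻ (range n) n w∈words
    with no132 , no321 ← avoids132-321⇒Avoids w avoids
    rewrite length-w
    with Classify.classify (isPerm⇒IsPermutation w∈words perm) no132 no321
  ... | ascending w≡id rewrite !-ext w length-w w≡id = multiplicity-identity
  ... | rotated a b 0<a 0<b a+b≤n w≡rot rewrite !-ext w length-w w≡rot = multiplicity-rotation 0<a 0<b a+b≤n

  numVHCAv≡1+nC3 : numVHCAv n ≡ 1 + n C 3
  numVHCAv≡1+nC3 = begin
    numVHCAv n
      ≡⟨ ∑-filterᵇ-enumeration avoids132-321 permutations enumeration numVHC enumerated complete ⟩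
    numVHC (identity n) + ∑ (map (uncurry (rotation n)) (shapes n)) numVHC
      ≡⟨ cong₂ _+_ (numVHC-identity n) (∑-map (uncurry (rotation n)) (shapes n) numVHC) ⟩
    1 + ∑[ (a , b) ∈ shapes n ] numVHC (rotation n a b)
      ≡⟨ cong suc (∑-cong (shapes n) numVHC-shape) ⟩
    1 + ∑[ (a , b) ∈ shapes n ] (n ∸ a ∸ b)
      ≡⟨ cong suc (∑-concatMap _ (range n) _) ⟩
    1 + ∑[ a ∈ range n ] ∑ (map (a ,_) (range (n ∸ a))) (λ (a , b) → n ∸ a ∸ b)
      ≡⟨ cong suc (∑-cong (range n) (λ {a} _ → ∑-map (a ,_) (range (n ∸ a)) _)) ⟩
    1 + ∑[ a ∈ range n ] ∑[ b ∈ range (n ∸ a) ] (n ∸ a ∸ b)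
      ≡⟨ cong suc (∑∑-range-∸ n) ⟩
    1 + n C 3 ∎
    where
    open ≡-Reasoning
    numVHC-shape : ∀ {s} → s ∈ shapes n → numVHC (uncurry (rotation n) s) ≡ n ∸ proj₁ s ∸ proj₂ s
    numVHC-shape {a , b} s∈shapes with 0<a , 0<b , a+b≤n ← ∈-shapes⁻ s∈shapes =
      trans (numVHC-rotation 0<a 0<b a+b≤n) (sym (∸-+-assoc n a b))

theorem4 : (n : ℕ) →
    + numVHCAv n ≡ (+ ((n + 3) C 3) ℤ.- + 3 ℤ.* + ((n + 2) C 3)) ℤ.+ + 3 ℤ.* + ((n + 1) C 3)
theorem4 n = trans (cong +_ (Counting.numVHCAv≡1+nC3 n)) (binomial-identity n)
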